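{- Let $G$ be a well-partitioned chordal graph with $n$ vertices and $k$ cut-vertices. Then $meg(G)=n-k$.
   Context: All graphs are finite and simple. A graph $G$ is well-partitioned chordal if $V(G)$ can be partitioned into cliques $C_1,\dots,C_\ell$ (called bags) such that for every two bags $C_i,C_j$, either there is no edge between $C_i$ and $C_j$ (non-adjacent bags), or the set of edges between $C_i$ and $C_j$ forms a complete bipartite graph (i.e., there are nonempty $P\subseteq C_i$, $Q\subseteq C_j$ such that the edges between $C_i$ and $C_j$ are exactly those joining $P$ and $Q$; adjacent bags), and the graph whose vertices are the bags, with two bags joined when adjacent, is a tree. A pair of vertices $u,v$ (or any vertex set containing them) monitors an edge $e$ if $e$ lies on every shortest $u$–$v$ path. A monitoring edge-geodetic set (MEG-set) of $G$ is a set $M\subseteq V(G)$ such that every edge of $G$ is monitored by some pair of vertices of $M$; $meg(G)$ is the minimum size of an MEG-set. -}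

module Defs where

open import Data.Nat using (ℕ; zero; suc; _≤_; _∸_)
open import Data.Fin using (Fin)
open import Data.Fin.Subset using (Subset; _∈_; _⊆_; ∣_∣; Nonempty)
open import Data.Bool using (Bool; true)
open import Data.List using (List; []; _∷_)
open import Data.List.Relation.Unary.Unique.Propositional using (Unique)
open import Data.Product using (Σ; ∃; ∃-syntax; _×_; _,_)
open import Data.Sum using (_⊎_)
open import Relation.Nullary using (¬_)
open import Relation.Binary.PropositionalEquality using (_≡_; _≢_)
open import Function.Bundles using (_⇔_)

record Graph (n : ℕ) : Set where
  field
    adj     : Fin n → Fin n → Bool
    symm    : ∀ u v → adj u v ≡ adj v u
    irrefl  : ∀ u → ¬ (adj u u ≡ true)

  Adj : Fin n → Fin n → Set
  Adj u v = adj u v ≡ true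

open Graph public

data Walk {m : ℕ} (R : Fin m → Fin m → Set) : Fin m → Fin m → ℕ → Set where
  here : ∀ {u} → Walk R u u 0
  step : ∀ {u w v ℓ} → R u w → Walk R w v ℓ → Walk R u v (suc ℓ)

verts : ∀ {m} {R : Fin m → Fin m → Set} {u v ℓ} → Walk R u v ℓ → List (Fin m)
verts (here {u}) = u ∷ []
verts (step {u} _ w) = u ∷ verts w

data UsesEdge {m : ℕ} {R : Fin m → Fin m → Set} (a b : Fin m) :
     ∀ {u v ℓ} → Walk R u v ℓ → Set where
  now   : ∀ {u w v ℓ} (r : R u w) (p : Walk R w v ℓ) →
          (u ≡ a × w ≡ b) ⊎ (u ≡ b × w ≡ a) → UsesEdge a b (step r p)
  later : ∀ {u w v ℓ} (r : R u w) (p : Walk R w v ℓ) →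
          UsesEdge a b p → UsesEdge a b (step r p)

Connected : ∀ {m} → (Fin m → Fin m → Set) → Set
Connected R = ∀ u v → ∃[ ℓ ] Walk R u v ℓ

-- a cycle: closed walk of length ≥ 3 whose vertices (apart from the
-- repeated start/end vertex) are pairwise distinct
HasCycle : ∀ {m} → (Fin m → Fin m → Set) → Set
HasCycle {m} R = Σ (Fin m) λ u → Σ ℕ λ ℓ → Σ (Walk R u u ℓ) λ w →
  3 ≤ ℓ × Unique (tailV w)
  where
  tailV : ∀ {u v ℓ} → Walk R u v ℓ → List (Fin m)
  tailV here = []
  tailV (step _ w) = verts w

IsTree : ∀ {m} → (Fin m → Fin m → Set) → Set
IsTree R = Connected R × ¬ HasCycle R

module _ {n : ℕ} (G : Graph n) where

  -- bag assignment: vertex v lies in bag (bag v); bags are the fibres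
  record WellPartition (ℓ : ℕ) : Set where
    field
      bag       : Fin n → Fin ℓ
      nonempty  : ∀ i → ∃[ v ] bag v ≡ i
      clique    : ∀ u v → bag u ≡ bag v → u ≢ v → Adj G u v
      bipartite : ∀ i j → i ≢ j →
        (∀ u v → bag u ≡ i → bag v ≡ j → ¬ Adj G u v)
        ⊎ (Σ (Subset n) λ P → Σ (Subset n) λ Q →
             Nonempty P × Nonempty Q ×
             (∀ u → u ∈ P → bag u ≡ i) × (∀ v → v ∈ Q → bag v ≡ j) ×
             (∀ u v → bag u ≡ i → bag v ≡ j → (Adj G u v ⇔ (u ∈ P × v ∈ Q))))

    BagAdj : Fin ℓ → Fin ℓ → Set
    BagAdj i j = i ≢ j × ∃[ u ] ∃[ v ] (bag u ≡ i × bag v ≡ j × Adj G u v)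

    field
      tree : IsTree BagAdj

  WellPartitionedChordal : Set
  WellPartitionedChordal = ∃[ ℓ ] WellPartition ℓ

  AdjWithout : Fin n → Fin n → Fin n → Set
  AdjWithout x u v = Adj G u v × u ≢ x × v ≢ x

  -- x is a cut-vertex: its removal disconnects two vertices that were
  -- connected in G (i.e. it increases the number of components)
  IsCutVertex : Fin n → Set
  IsCutVertex x = ∃[ a ] ∃[ b ] (a ≢ x × b ≢ x ×
    (∃[ ℓ ] Walk (Adj G) a b ℓ) × ¬ (∃[ ℓ ] Walk (AdjWithout x) a b ℓ))

  IsShortest : ∀ {u v ℓ} → Walk (Adj G) u v ℓ → Set
  IsShortest {u} {v} {ℓ} _ = ∀ ℓ' → Walk (Adj G) u v ℓ' → ℓ ≤ ℓ'

  Monitors : Fin n → Fin n → Fin n → Fin n → Set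
  Monitors u v a b = ∀ ℓ (w : Walk (Adj G) u v ℓ) → IsShortest w → UsesEdge a b w

  IsMEGSet : Subset n → Set
  IsMEGSet M = ∀ a b → Adj G a b →
    ∃[ u ] ∃[ v ] (u ∈ M × v ∈ M × Monitors u v a b)

  MegEquals : ℕ → Set
  MegEquals m = (∃[ M ] (IsMEGSet M × ∣ M ∣ ≡ m))
              × (∀ M → IsMEGSet M → m ≤ ∣ M ∣)

{-# OPTIONS --safe #-}
module Submission where

-- The non-cut vertices form an MEG-set in any connected graph: for an edge ab, start with x = a
-- and, while x is a cut vertex, replace x by a vertex that x cuts off from b. Every walk from the
-- new x to b still passes through a, and its distance to b grows, so the process stops at a
-- non-cut vertex x. Choosing y symmetrically for b, every shortest x–y path runs x … a b … y.
-- Conversely, in a well-partitioned chordal graph a non-cut vertex v has a neighbour u (a bagmate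
-- if v has one) such that every induced path u – v – w lies on a 4-cycle u – v – w – z: otherwise
-- v would separate u from w, since every edge of the bag tree is a bridge. A shortest path through
-- uv that does not end at v can then be rerouted through z, so v belongs to every MEG-set.

open import Defs
open import Data.Nat using (ℕ; zero; suc; _+_; _≤_; _<_; _∸_; z≤n; s≤s)
open import Data.Nat.Properties
  using (anyUpTo?; <⇒≱; ≮⇒≥; ≤-<-trans; ≤-trans; ≤-pred; +-cancelˡ-≤; +-cancelʳ-≤; +-mono-≤;
         +-monoˡ-≤; +-suc; 1+n≰n; n≤1+n; m≤n+m; +-identityʳ)
open import Data.Nat.Induction using (<-rec)
open import Data.Fin as Fin using (Fin; _≟_)
open import Data.Fin.Properties using (injective⇒≤; any?)
open import Data.Fin.Subset using (Subset; _∈_; ∣_∣; ∁)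
open import Data.Fin.Subset.Properties using (_∈?_; ∣∁p∣≡n∸∣p∣; p⊆q⇒∣p∣≤∣q∣; x∉p⇒x∈∁p; x∈∁p⇒x∉p)
open import Data.Bool using (true)
import Data.Bool.Properties as Bool
open import Data.List using (List; []; _∷_; length; lookup)
open import Data.List.Membership.Propositional using () renaming (_∈_ to _∈ˡ_)
open import Data.List.Membership.Propositional.Properties using (∈-lookup)
open import Data.List.Relation.Unary.Any as Any using (here; there)
open import Data.List.Relation.Unary.All as All using ([]; _∷_)
open import Data.List.Relation.Unary.All.Properties using (¬Any⇒All¬)
open import Data.List.Relation.Unary.AllPairs using ([]; _∷_)
open import Data.List.Relation.Unary.Unique.Propositional using (Unique)
open import Data.Product as Product using (Σ; ∃; _×_; _,_; proj₁; proj₂)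
open import Data.Sum as Sum using (_⊎_; inj₁; inj₂)
open import Data.Empty using (⊥-elim)
open import Relation.Nullary using (¬_; Dec; yes; no; ¬?; _×-dec_; _⊎-dec_)
import Relation.Nullary.Decidable as Dec
open import Relation.Unary using (Decidable)
open import Relation.Binary.PropositionalEquality using (_≡_; _≢_; refl; sym; trans; cong; subst)
open import Function using (_∘_; id)
open import Function.Bundles using (_⇔_; Equivalence)

private variable
  m k l l₁ l₂ : ℕ

Least : (ℕ → Set) → ℕ → Set
Least P j = P j × (∀ i → P i → j ≤ i)

least : {P : ℕ → Set} → Decidable P → P k → ∃ (Least P)
least {P = P} P? = <-rec (λ k → P k → ∃ (Least P)) search _
  where
  search : ∀ k → (∀ {j} → j < k → P j → ∃ (Least P)) → P k → ∃ (Least P)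
  search k smaller pk with anyUpTo? P? k
  ... | yes (j , j<k , pj) = smaller j<k pj
  ... | no ∄smaller = k , pk , λ i pi → ≮⇒≥ (λ i<k → ∄smaller (i , i<k , pi))

lookup-injective : {A : Set} {xs : List A} → Unique xs → ∀ {i j} → lookup xs i ≡ lookup xs j → i ≡ j
lookup-injective (_ ∷ _)     {Fin.zero}  {Fin.zero}  _  = refl
lookup-injective (x∉xs ∷ _)  {Fin.zero}  {Fin.suc j} eq = ⊥-elim (All.lookup x∉xs (∈-lookup j) eq)
lookup-injective (x∉xs ∷ _)  {Fin.suc i} {Fin.zero}  eq = ⊥-elim (All.lookup x∉xs (∈-lookup i) (sym eq))
lookup-injective (_ ∷ uniq) {Fin.suc i} {Fin.suc j} eq = cong Fin.suc (lookup-injective uniq eq)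

unique⇒length≤ : {xs : List (Fin m)} → Unique xs → length xs ≤ m
unique⇒length≤ uniq = injective⇒≤ (lookup-injective uniq)

anotherVertex : 2 ≤ m → (v : Fin m) → ∃ λ t → t ≢ v
anotherVertex (s≤s (s≤s _)) Fin.zero    = Fin.suc Fin.zero , λ ()
anotherVertex (s≤s (s≤s _)) (Fin.suc _) = Fin.zero , λ ()

-- Walks

module _ {m : ℕ} {R : Fin m → Fin m → Set} where

  private variable
    u v w c : Fin m

  infix 4 _∈ʷ_
  _∈ʷ_ : Fin m → Walk R u v l → Set
  c ∈ʷ p = c ∈ˡ verts p

  _∈ʷ?_ : (c : Fin m) (p : Walk R u v l) → Dec (c ∈ʷ p)
  c ∈ʷ? p = Any.any? (c ≟_) (verts p)

  source∈ʷ : (p : Walk R u v l) → u ∈ʷ p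
  source∈ʷ here       = here refl
  source∈ʷ (step _ _) = here refl

  walk-length>0 : u ≢ v → Walk R u v l → 0 < l
  walk-length>0 u≢v here       = ⊥-elim (u≢v refl)
  walk-length>0 u≢v (step _ _) = s≤s z≤n

  firstStep : u ≢ v → Walk R u v l → ∃ (R u)
  firstStep u≢v here       = ⊥-elim (u≢v refl)
  firstStep u≢v (step r _) = _ , r

  infixr 5 _++ʷ_
  _++ʷ_ : Walk R u v l₁ → Walk R v w l₂ → Walk R u w (l₁ + l₂)
  here     ++ʷ q = q
  step r p ++ʷ q = step r (p ++ʷ q)

  ∈-++ʷ⁻ : (p : Walk R u v l₁) (q : Walk R v w l₂) → c ∈ʷ p ++ʷ q → c ∈ʷ p ⊎ c ∈ʷ q
  ∈-++ʷ⁻ here       q c∈q          = inj₂ c∈q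
  ∈-++ʷ⁻ (step r p) q (here refl)  = inj₁ (here refl)
  ∈-++ʷ⁻ (step r p) q (there c∈pq) = Sum.map₁ there (∈-++ʷ⁻ p q c∈pq)

  mapʷ : {R′ : Fin m → Fin m → Set} → (∀ {x y} → R x y → R′ x y) → Walk R u v l → Walk R′ u v l
  mapʷ f here       = here
  mapʷ f (step r p) = step (f r) (mapʷ f p)

  verts-mapʷ : {R′ : Fin m → Fin m → Set} (f : ∀ {x y} → R x y → R′ x y) (p : Walk R u v l) →
               verts (mapʷ f p) ≡ verts p
  verts-mapʷ f here       = refl
  verts-mapʷ f (step r p) = cong (_ ∷_) (verts-mapʷ f p)

  reverseʷ : (∀ {x y} → R x y → R y x) → (p : Walk R u v l) →
             ∃ λ l′ → Σ (Walk R v u l′) λ q → ∀ {c} → c ∈ʷ q → c ∈ʷ p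
  reverseʷ R-sym here = 0 , here , id
  reverseʷ R-sym (step r p) with reverseʷ R-sym p
  ... | l′ , q , q⊆p = l′ + 1 , q ++ʷ step (R-sym r) here , back
    where
    back : ∀ {c} → c ∈ʷ q ++ʷ step (R-sym r) here → c ∈ʷ step r p
    back c∈ with ∈-++ʷ⁻ q (step (R-sym r) here) c∈
    ... | inj₁ c∈q                 = there (q⊆p c∈q)
    ... | inj₂ (here refl)         = there (source∈ʷ p)
    ... | inj₂ (there (here refl)) = here refl

  record Split (p : Walk R u v l) (c : Fin m) : Set where
    field
      length₁ length₂ : ℕ
      prefix          : Walk R u c length₁
      suffix          : Walk R c v length₂
      length-+        : length₁ + length₂ ≡ l
      prefix-edges    : ∀ {a b} → UsesEdge a b prefix → UsesEdge a b p
      suffix-edges    : ∀ {a b} → UsesEdge a b suffix → UsesEdge a b p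
      suffix-verts    : ∀ {a} → a ∈ʷ suffix → a ∈ʷ p

  splitAt : (p : Walk R u v l) → c ∈ʷ p → Split p c
  splitAt here (here refl) = record
    { length₁ = 0 ; length₂ = 0 ; prefix = here ; suffix = here ; length-+ = refl
    ; prefix-edges = λ () ; suffix-edges = λ () ; suffix-verts = id }
  splitAt (step r p) (here refl) = record
    { length₁ = 0 ; length₂ = _ ; prefix = here ; suffix = step r p ; length-+ = refl
    ; prefix-edges = λ () ; suffix-edges = id ; suffix-verts = id }
  splitAt (step r p) (there c∈p) = record
    { length₁ = suc length₁ ; length₂ = length₂
    ; prefix = step r prefix ; suffix = suffix ; length-+ = cong suc length-+
    ; prefix-edges = λ { (now _ _ e) → now r p e ; (later _ _ e) → later r p (prefix-edges e) }
    ; suffix-edges = later r p ∘ suffix-edges ; suffix-verts = there ∘ suffix-verts }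
    where open Split (splitAt p c∈p)

  prefixToFirst : {P : Fin m → Set} → Decidable P → (p : Walk R u v l) → P v →
    ∃ λ z → P z × ∃ λ l′ → Σ (Walk R u z l′) λ q → ∀ {c} → c ∈ʷ q → P c → c ≡ z
  prefixToFirst {u = u} P? here pv = u , pv , 0 , here , λ { (here refl) _ → refl }
  prefixToFirst {u = u} P? (step r p) pv with P? u
  ... | yes pu = u , pu , 0 , here , λ { (here refl) _ → refl }
  ... | no ¬pu with prefixToFirst P? p pv
  ...   | z , pz , l′ , q , first = z , pz , suc l′ , step r q ,
          λ { (here refl) pc → ⊥-elim (¬pu pc) ; (there c∈q) pc → first c∈q pc }

  short-walk-uses : u ≢ v → (p : Walk R u v l) → l ≤ 1 → UsesEdge u v p
  short-walk-uses u≢v here                _        = ⊥-elim (u≢v refl)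
  short-walk-uses u≢v (step r here)       _        = now r here (inj₁ (refl , refl))
  short-walk-uses u≢v (step _ (step _ _)) (s≤s ())

  IsPath : Walk R u v l → Set
  IsPath p = Unique (verts p)

  suffixFrom : (p : Walk R u v l) → c ∈ʷ p → IsPath p → ∃ λ l′ → Σ (Walk R c v l′) IsPath
  suffixFrom here       (here refl) uniq       = 0 , here , uniq
  suffixFrom (step r p) (here refl) uniq       = _ , step r p , uniq
  suffixFrom (step r p) (there c∈p) (_ ∷ uniq) = suffixFrom p c∈p uniq

  toPath : Walk R u v l → ∃ λ l′ → Σ (Walk R u v l′) IsPath
  toPath here = 0 , here , [] ∷ []
  toPath (step {u} r p) with toPath p
  ... | l′ , q , uniq with u ∈ʷ? q
  ...   | yes u∈q = suffixFrom q u∈q uniq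
  ...   | no  u∉q = suc l′ , step r q , ¬Any⇒All¬ (verts q) u∉q ∷ uniq

  length-verts : (p : Walk R u v l) → length (verts p) ≡ suc l
  length-verts here       = refl
  length-verts (step r p) = cong suc (length-verts p)

  shortcut : Walk R u v l → ∃ λ l′ → l′ < m × Walk R u v l′
  shortcut p with toPath p
  ... | l′ , q , uniq = l′ , subst (_≤ m) (length-verts q) (unique⇒length≤ uniq) , q

Reachable : (Fin m → Fin m → Set) → Fin m → Fin m → Set
Reachable R u v = ∃ λ l → Walk R u v l

module _ {m : ℕ} {R : Fin m → Fin m → Set} (R? : ∀ x y → Dec (R x y)) where

  walk? : ∀ u v l → Dec (Walk R u v l)
  walk? u v zero with u ≟ v
  ... | yes refl = yes here
  ... | no  u≢v  = no λ { here → u≢v refl }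
  walk? u v (suc l) with any? (λ w → R? u w ×-dec walk? w v l)
  ... | yes (w , r , p) = yes (step r p)
  ... | no  ∄w          = no λ { (step r p) → ∄w (_ , r , p) }

  reachable? : ∀ u v → Dec (Reachable R u v)
  reachable? u v with anyUpTo? (walk? u v) m
  ... | yes (l , _ , p) = yes (l , p)
  ... | no  ∄short      = no λ (l , p) → ∄short (shortcut p)

  shortestWalk : ∀ {u v} → Walk R u v l → ∃ (Least (Walk R u v))
  shortestWalk {u = u} {v} = least (walk? u v)

  shortest-length< : ∀ {u v} → Least (Walk R u v) k → k < m
  shortest-length< (p , minimal) with shortcut p
  ... | l′ , l′<m , q = ≤-<-trans (minimal l′ q) l′<m

EdgeDeleted : (Fin m → Fin m → Set) → Fin m → Fin m → Fin m → Fin m → Set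
EdgeDeleted R i j x y = R x y × ¬ (x ≡ i × y ≡ j) × ¬ (x ≡ j × y ≡ i)

acyclic⇒bridge : {R : Fin m → Fin m → Set} {i j : Fin m} → (∀ {x} → ¬ R x x) → ¬ HasCycle R →
                 R j i → ¬ Walk (EdgeDeleted R i j) i j l
acyclic⇒bridge R-irrefl acyclic ji p with toPath p
... | _ , here , _        = R-irrefl ji
... | _ , step e here , _ = proj₁ (proj₂ e) (refl , refl)
... | _ , q@(step _ (step _ _)) , uniq =
  acyclic (_ , _ , step ji (mapʷ proj₁ q) , s≤s (s≤s (s≤s z≤n)) ,
           subst Unique (sym (verts-mapʷ proj₁ q)) uniq)

collapseWalk : {R : Fin m → Fin m → Set} {S : Fin k → Fin k → Set} (f : Fin m → Fin k) →
               (∀ {x y} → R x y → f x ≢ f y → S (f x) (f y)) →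
               ∀ {u v} → Walk R u v l → Reachable S (f u) (f v)
collapseWalk f g here = 0 , here
collapseWalk {S = S} f g {u} {v} (step {w = w} r p) with collapseWalk f g p | f u ≟ f w
... | l′ , q | yes fu≡fw = l′ , subst (λ t → Walk S t (f v) l′) (sym fu≡fw) q
... | l′ , q | no  fu≢fw = suc l′ , step (g r fu≢fw) q

module _ {n : ℕ} (G : Graph n) where

  private variable
    a b c u v w x x₂ y z : Fin n

  adj? : ∀ x y → Dec (Adj G x y)
  adj? x y = adj G x y Bool.≟ true

  Adj-sym : Adj G x y → Adj G y x
  Adj-sym {x} {y} e = trans (symm G y x) e

  Adj⇒≢ : Adj G x y → x ≢ y
  Adj⇒≢ {x} e refl = irrefl G x e

  adjWithout? : ∀ x u v → Dec (AdjWithout G x u v)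
  adjWithout? x u v = adj? u v ×-dec ¬? (u ≟ x) ×-dec ¬? (v ≟ x)

  AdjWithout-sym : AdjWithout G x u v → AdjWithout G x v u
  AdjWithout-sym (e , u≢x , v≢x) = Adj-sym e , v≢x , u≢x

  avoiding : (p : Walk (Adj G) u v l) → ¬ x ∈ʷ p → Walk (AdjWithout G x) u v l
  avoiding here       _   = here
  avoiding {u} {x = x} (step {w = w} e p) x∉p = step (e , u≢x , w≢x) (avoiding p (x∉p ∘ there))
    where
    u≢x : u ≢ x
    u≢x u≡x = x∉p (here (sym u≡x))
    w≢x : w ≢ x
    w≢x w≡x = x∉p (there (subst (_∈ʷ p) w≡x (source∈ʷ p)))

  shortest-tail : (e : Adj G x w) (p : Walk (Adj G) w y l) → IsShortest G (step e p) → IsShortest G p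
  shortest-tail e p p-min l′ q = ≤-pred (p-min _ (step e q))

  shortest-suffix : (p : Walk (Adj G) u v l) → IsShortest G p → (s : Split p c) →
                    IsShortest G (Split.suffix s)
  shortest-suffix p p-min s l′ q =
    +-cancelˡ-≤ length₁ length₂ l′ (subst (_≤ length₁ + l′) (sym length-+) (p-min _ (prefix ++ʷ q)))
    where open Split s

  shortest-visiting-neighbour : Adj G a b → (q : Walk (Adj G) a y l) → IsShortest G q → b ∈ʷ q →
                                UsesEdge a b q
  shortest-visiting-neighbour ab q q-min b∈q = prefix-edges (short-walk-uses (Adj⇒≢ ab) prefix length₁≤1)
    where
    open Split (splitAt q b∈q)
    length₁≤1 : length₁ ≤ 1
    length₁≤1 = +-cancelʳ-≤ length₂ length₁ 1
                  (subst (_≤ 1 + length₂) (sym length-+) (q-min _ (step ab suffix)))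

  -- Separators and the upper bound

  Separates : Fin n → Fin n → Fin n → Set
  Separates a x b = ∀ l (p : Walk (Adj G) x b l) → a ∈ʷ p

  unreachable⇒separates : ¬ Reachable (AdjWithout G a) x b → Separates a x b
  unreachable⇒separates {a} unreachable l p with a ∈ʷ? p
  ... | yes a∈p = a∈p
  ... | no  a∉p = ⊥-elim (unreachable (l , avoiding p a∉p))

  separates-trans : Separates a x b → Separates x z b → Separates a z b
  separates-trans a∣x x∣z l p = suffix-verts (a∣x _ suffix)
    where open Split (splitAt p (x∣z l p))

  cut⇒separates : IsCutVertex G x → ∀ b → ∃ λ z → z ≢ x × Separates x z b
  cut⇒separates {x} (s , t , s≢x , t≢x , _ , s↮t) b with reachable? (adjWithout? x) s b
  ... | no s↛b = s , s≢x , unreachable⇒separates s↛b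
  ... | yes (_ , s→b) with reachable? (adjWithout? x) t b
  ...   | no  t↛b       = t , t≢x , unreachable⇒separates t↛b
  ...   | yes (_ , t→b) = ⊥-elim (s↮t (_ , s→b ++ʷ proj₁ (proj₂ (reverseʷ AdjWithout-sym t→b))))

  separates⇒farther : Separates x z b → z ≢ x →
                      Least (Walk (Adj G) x b) k → Least (Walk (Adj G) z b) l → k < l
  separates⇒farther {k = k} x∣z z≢x (_ , x-min) (p , _) =
    subst (suc k ≤_) length-+ (+-mono-≤ (walk-length>0 z≢x prefix) (x-min _ suffix))
    where open Split (splitAt p (x∣z _ p))

  module _ (connected : Connected (Adj G)) where

    distance : ∀ x y → ∃ (Least (Walk (Adj G) x y))
    distance x y = shortestWalk adj? (proj₂ (connected x y))

    neighbour : 2 ≤ n → ∀ v → ∃ (Adj G v)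
    neighbour 2≤n v with anotherVertex 2≤n v
    ... | t , t≢v = firstStep (t≢v ∘ sym) (proj₂ (connected v t))

    unreachable⇒cut : a ≢ x → b ≢ x → ¬ Reachable (AdjWithout G x) a b → IsCutVertex G x
    unreachable⇒cut {a} {x} {b} a≢x b≢x a↛b = a , b , a≢x , b≢x , connected a b , a↛b

    nonCutSeparator : Decidable (IsCutVertex G) → ∀ a b → ∃ λ x → ¬ IsCutVertex G x × Separates a x b
    nonCutSeparator cut? a b = descend n a (λ _ → source∈ʷ) (distance a b) (m≤n+m n _)
      where
      descend : ∀ fuel x → Separates a x b → (d : ∃ (Least (Walk (Adj G) x b))) → n ≤ proj₁ d + fuel →
                ∃ λ x′ → ¬ IsCutVertex G x′ × Separates a x′ b
      descend zero x _ (d , x-dist) n≤d+0 =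
        ⊥-elim (<⇒≱ (shortest-length< adj? x-dist) (subst (n ≤_) (+-identityʳ d) n≤d+0))
      descend (suc fuel) x a∣x (d , x-dist) n≤d+1+fuel with cut? x
      ... | no ¬cut = x , ¬cut , a∣x
      ... | yes cut with cut⇒separates cut b
      ...   | z , z≢x , x∣z with distance z b
      ...     | dz , z-dist = descend fuel z (separates-trans a∣x x∣z) (dz , z-dist)
                  (≤-trans (subst (n ≤_) (+-suc d fuel) n≤d+1+fuel)
                           (+-monoˡ-≤ fuel (separates⇒farther x∣z z≢x x-dist z-dist)))

    separators-visit : a ≢ b → Separates a x b → Separates b y a → (p : Walk (Adj G) x y l) → a ∈ʷ p
    separators-visit {a} {b} {y = y} a≢b a∣x b∣y p with a ∈ʷ? p
    ... | yes a∈p = a∈p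
    ... | no  a∉p with prefixToFirst (λ c → (c ≟ a) ⊎-dec (c ≟ b)) (proj₂ (connected y a)) (inj₁ refl)
    ...   | _ , inj₁ refl , _ , q , first = ⊥-elim (a≢b (sym (first (b∣y _ q) (inj₂ refl))))
    ...   | _ , inj₂ refl , _ , q , first with ∈-++ʷ⁻ p q (a∣x _ (p ++ʷ q))
    ...     | inj₁ a∈p = ⊥-elim (a∉p a∈p)
    ...     | inj₂ a∈q = ⊥-elim (a≢b (first a∈q (inj₁ refl)))

    separators-monitor : Adj G a b → Separates a x b → Separates b y a → Monitors G x y a b
    separators-monitor {a} {b} ab a∣x b∣y l p p-min =
      suffix-edges (shortest-visiting-neighbour ab suffix (shortest-suffix p p-min split) b∈suffix)
      where
      split : Split p a
      split = splitAt p (separators-visit (Adj⇒≢ ab) a∣x b∣y p)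
      open Split split
      b∈suffix : b ∈ʷ suffix
      b∈suffix with reverseʷ Adj-sym suffix
      ... | _ , back , back⊆suffix = back⊆suffix (b∣y _ back)

    ⊇nonCut⇒MEGSet : Decidable (IsCutVertex G) → ∀ M → (∀ x → ¬ IsCutVertex G x → x ∈ M) → IsMEGSet G M
    ⊇nonCut⇒MEGSet cut? M nonCut⊆M a b ab with nonCutSeparator cut? a b | nonCutSeparator cut? b a
    ... | x , x-nonCut , a∣x | y , y-nonCut , b∣y =
      x , y , nonCut⊆M x x-nonCut , nonCut⊆M y y-nonCut , separators-monitor ab a∣x b∣y

  -- Vertices forced into every MEG-set

  Detours : Fin n → Fin n → Set
  Detours u v = ∀ w → Adj G v w → w ≢ u → ¬ Adj G u w → ∃ λ z → z ≢ v × Adj G u z × Adj G z w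

  avoid-step : {e : Adj G x w} {p : Walk (Adj G) w y l} → (x ≢ v × w ≢ v) ⊎ (x ≢ u × w ≢ u) →
               ¬ UsesEdge u v p → ¬ UsesEdge u v (step e p)
  avoid-step (inj₁ (_ , w≢v)) _ (now _ _ (inj₁ (_ , w≡v))) = w≢v w≡v
  avoid-step (inj₁ (x≢v , _)) _ (now _ _ (inj₂ (x≡v , _))) = x≢v x≡v
  avoid-step (inj₂ (x≢u , _)) _ (now _ _ (inj₁ (x≡u , _))) = x≢u x≡u
  avoid-step (inj₂ (_ , w≢u)) _ (now _ _ (inj₂ (_ , w≡u))) = w≢u w≡u
  avoid-step _ p-avoids (later _ _ uses) = p-avoids uses

  shortest⇒induced : (e : Adj G x v) (e₂ : Adj G v x₂) (p : Walk (Adj G) x₂ y l) →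
                     IsShortest G (step e (step e₂ p)) → x ≢ x₂ × ¬ Adj G x x₂
  shortest⇒induced e e₂ p p-min =
    (λ { refl → 1+n≰n (≤-trans (n≤1+n _) (p-min _ p)) }) , (λ e′ → 1+n≰n (p-min _ (step e′ p)))

  module _ {u v : Fin n} (uv : Adj G u v) (detours : Detours u v) where

    bypass : (e : Adj G x v) (e₂ : Adj G v x₂) → x ≢ x₂ → ¬ Adj G x x₂ → x ≢ v → x₂ ≢ v →
             (p : Walk (Adj G) x₂ y l) → ¬ UsesEdge u v p →
             Σ (Walk (Adj G) x y (2 + l)) λ q → ¬ UsesEdge u v q
    bypass {x} {x₂} e e₂ x≢x₂ ¬xx₂ x≢v x₂≢v p p-avoids with x ≟ u | x₂ ≟ u
    ... | yes refl | _ with detours x₂ e₂ (x≢x₂ ∘ sym) ¬xx₂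
    ...   | z , z≢v , uz , zx₂ =
      step uz (step zx₂ p) , avoid-step (inj₁ (x≢v , z≢v)) (avoid-step (inj₁ (z≢v , x₂≢v)) p-avoids)
    bypass {x} {x₂} e e₂ x≢x₂ ¬xx₂ x≢v x₂≢v p p-avoids | no x≢u | yes refl
      with detours x (Adj-sym e) x≢u (¬xx₂ ∘ Adj-sym)
    ... | z , z≢v , uz , zx =
      step (Adj-sym zx) (step (Adj-sym uz) p) ,
      avoid-step (inj₁ (x≢v , z≢v)) (avoid-step (inj₁ (z≢v , x₂≢v)) p-avoids)
    bypass {x} {x₂} e e₂ x≢x₂ ¬xx₂ x≢v x₂≢v p p-avoids | no x≢u | no x₂≢u =
      step e (step e₂ p) , avoid-step (inj₂ (x≢u , v≢u)) (avoid-step (inj₂ (v≢u , x₂≢u)) p-avoids)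
      where
      v≢u : v ≢ u
      v≢u = Adj⇒≢ uv ∘ sym

    reroute : (p : Walk (Adj G) x y l) → IsShortest G p → x ≢ v → y ≢ v →
              Σ (Walk (Adj G) x y l) λ q → ¬ UsesEdge u v q
    reroute here _ _ _ = here , λ ()
    reroute (step {w = x₁} e p) p-min x≢v y≢v with x₁ ≟ v
    reroute (step e p) p-min x≢v y≢v | no x₁≢v with reroute p (shortest-tail e p p-min) x₁≢v y≢v
    ... | p′ , p′-avoids = step e p′ , avoid-step (inj₁ (x≢v , x₁≢v)) p′-avoids
    reroute (step e here) _ _ y≢v | yes refl = ⊥-elim (y≢v refl)
    reroute (step e (step e₂ p)) p-min x≢v y≢v | yes refl
      with reroute p (shortest-tail e₂ p (shortest-tail e (step e₂ p) p-min)) (Adj⇒≢ e₂ ∘ sym) y≢v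
    ... | p′ , p′-avoids with shortest⇒induced e e₂ p p-min
    ...   | x≢x₂ , ¬xx₂ = bypass e e₂ x≢x₂ ¬xx₂ x≢v (Adj⇒≢ e₂ ∘ sym) p′ p′-avoids

    detour⇒∈MEGSet : Connected (Adj G) → ∀ M → IsMEGSet G M → v ∈ M
    detour⇒∈MEGSet connected M meg with v ∈? M
    ... | yes v∈M = v∈M
    ... | no  v∉M with meg u v uv
    ...   | x , y , x∈M , y∈M , monitors with distance connected x y
    ...     | l , p , p-min with reroute p p-min (λ { refl → v∉M x∈M }) (λ { refl → v∉M y∈M })
    ...       | p′ , p′-avoids = ⊥-elim (p′-avoids (monitors l p′ p-min))

-- Well-partitioned chordal graphs

module _ {n : ℕ} {G : Graph n} {ℓ : ℕ} (WP : WellPartition G ℓ) where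
  open WellPartition WP

  private variable
    u v w x y : Fin n
    i j : Fin ℓ

  sameBag-reachable : bag u ≡ bag v → Reachable (Adj G) u v
  sameBag-reachable {u} {v} same with u ≟ v
  ... | yes refl = 0 , here
  ... | no  u≢v  = 1 , step (clique u v same u≢v) here

  liftWalk : Walk BagAdj i j l → bag u ≡ i → bag v ≡ j → Reachable (Adj G) u v
  liftWalk here u∈i v∈j = sameBag-reachable (trans u∈i (sym v∈j))
  liftWalk (step (_ , x , y , x∈i , y∈k , xy) q) u∈i v∈j
    with sameBag-reachable (trans u∈i (sym x∈i)) | liftWalk q y∈k v∈j
  ... | _ , u→x | _ , y→v = _ , u→x ++ʷ step xy y→v

  connected : Connected (Adj G)
  connected u v = liftWalk (proj₂ (proj₁ tree (bag u) (bag v))) refl refl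

  bagStep : Adj G x y → bag x ≢ bag y → BagAdj (bag x) (bag y)
  bagStep xy different = different , _ , _ , refl , refl , xy

  bagBridge : BagAdj j i → ¬ Walk (EdgeDeleted BagAdj i j) i j l
  bagBridge = acyclic⇒bridge (λ (i≢i , _) → i≢i refl) (proj₂ tree)

  nonAdjacent⇒differentBags : x ≢ y → ¬ Adj G x y → bag x ≢ bag y
  nonAdjacent⇒differentBags x≢y ¬xy same = ¬xy (clique _ _ same x≢y)

  crossEdges-complete : Adj G x y → Adj G u w → bag u ≡ bag x → bag w ≡ bag y → bag x ≢ bag y → Adj G x w
  crossEdges-complete {x} {y} {u} {w} xy uw u~x w~y different with bipartite (bag x) (bag y) different
  ... | inj₁ no-edges = ⊥-elim (no-edges x y refl refl xy)
  ... | inj₂ (P , Q , _ , _ , _ , _ , edges⇔) =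
    Equivalence.from (edges⇔ x w refl w~y)
      (proj₁ (Equivalence.to (edges⇔ x y refl refl) xy) , proj₂ (Equivalence.to (edges⇔ u w u~x w~y) uw))

  module _ {v w : Fin n} (vw : Adj G v w) (bagv≢bagw : bag v ≢ bag w)
           (attached : ∀ x y → bag x ≡ bag v → bag y ≡ bag w → Adj G x y → x ≡ v) where

    collapseAvoiding : Walk (AdjWithout G v) x y l →
                       Reachable (EdgeDeleted BagAdj (bag v) (bag w)) (bag x) (bag y)
    collapseAvoiding = collapseWalk bag λ (xy , x≢v , y≢v) different →
      bagStep xy different ,
      (λ (x∈v , y∈w) → x≢v (attached _ _ x∈v y∈w xy)) ,
      (λ (x∈w , y∈v) → y≢v (attached _ _ y∈v x∈w (Adj-sym G xy)))

    noBagWalk : bag x ≡ bag v → ¬ Reachable (EdgeDeleted BagAdj (bag v) (bag w)) (bag x) (bag w)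
    noBagWalk x∈v (l′ , q) = bagBridge (bagStep (Adj-sym G vw) (bagv≢bagw ∘ sym))
      (subst (λ i → Walk (EdgeDeleted BagAdj (bag v) (bag w)) i (bag w) l′) x∈v q)

  sharedBag-separates : bag u ≡ bag v → Adj G v w → w ≢ u → ¬ Adj G u w →
                        (∀ z → z ≢ v → Adj G u z → ¬ Adj G z w) → ¬ Reachable (AdjWithout G v) u w
  sharedBag-separates {u} {v} {w} u~v vw w≢u ¬uw no-detour (_ , p) =
    noBagWalk vw bagv≢bagw attached u~v (collapseAvoiding vw bagv≢bagw attached p)
    where
    bagv≢bagw : bag v ≢ bag w
    bagv≢bagw = nonAdjacent⇒differentBags (w≢u ∘ sym) ¬uw ∘ trans u~v
    attached : ∀ x y → bag x ≡ bag v → bag y ≡ bag w → Adj G x y → x ≡ v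
    attached x y x∈v y∈w xy with x ≟ v
    ... | yes x≡v = x≡v
    ... | no  x≢v = ⊥-elim (no-detour x x≢v ux xw)
      where
      xw : Adj G x w
      xw = crossEdges-complete xy vw (sym x∈v) (sym y∈w)
             λ x~y → bagv≢bagw (trans (sym x∈v) (trans x~y y∈w))
      ux : Adj G u x
      ux = clique u x (trans u~v (sym x∈v)) λ { refl → ¬uw xw }

  soleBag-separates : (∀ x → bag x ≡ bag v → x ≡ v) → Adj G v u → Adj G v w → w ≢ u → ¬ Adj G u w →
                      ¬ Reachable (AdjWithout G v) u w
  soleBag-separates {v} {u} {w} sole vu vw w≢u ¬uw (_ , p) =
    noBagWalk vw (leavesBag vw) attached refl
      (Product.map suc (step firstBagStep) (collapseAvoiding vw (leavesBag vw) attached p))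
    where
    leavesBag : Adj G v x → bag v ≢ bag x
    leavesBag {x} vx v~x = Adj⇒≢ G vx (sym (sole x (sym v~x)))
    attached : ∀ x y → bag x ≡ bag v → bag y ≡ bag w → Adj G x y → x ≡ v
    attached x _ x∈v _ _ = sole x x∈v
    firstBagStep : EdgeDeleted BagAdj (bag v) (bag w) (bag v) (bag u)
    firstBagStep = bagStep vu (leavesBag vu) ,
                   (λ (_ , u~w) → nonAdjacent⇒differentBags (w≢u ∘ sym) ¬uw u~w) ,
                   (λ (v~w , _) → leavesBag vw v~w)

  nonCut⇒detour : 2 ≤ n → ¬ IsCutVertex G v → ∃ λ u → Adj G u v × Detours G u v
  nonCut⇒detour {v} 2≤n ¬cut with any? (λ u → ¬? (u ≟ v) ×-dec (bag u ≟ bag v))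
  ... | yes (u , u≢v , u~v) = u , clique u v u~v u≢v , detours
    where
    detours : Detours G u v
    detours w vw w≢u ¬uw with any? (λ z → ¬? (z ≟ v) ×-dec (adj? G u z ×-dec adj? G z w))
    ... | yes detour = detour
    ... | no  ∄detour = ⊥-elim (¬cut (unreachable⇒cut G connected u≢v (Adj⇒≢ G vw ∘ sym)
            (sharedBag-separates u~v vw w≢u ¬uw λ z z≢v uz zw → ∄detour (z , z≢v , uz , zw))))
  ... | no ∄bagmate with neighbour G connected 2≤n v
  ...   | u , vu = u , Adj-sym G vu , λ w vw w≢u ¬uw →
          ⊥-elim (¬cut (unreachable⇒cut G connected (Adj⇒≢ G vu ∘ sym) (Adj⇒≢ G vw ∘ sym)
                          (soleBag-separates sole vu vw w≢u ¬uw)))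
    where
    sole : ∀ x → bag x ≡ bag v → x ≡ v
    sole x x~v with x ≟ v
    ... | yes x≡v = x≡v
    ... | no  x≢v = ⊥-elim (∄bagmate (x , x≢v , x~v))

  nonCut∈MEGSet : 2 ≤ n → ¬ IsCutVertex G v → ∀ M → IsMEGSet G M → v ∈ M
  nonCut∈MEGSet 2≤n ¬cut with nonCut⇒detour 2≤n ¬cut
  ... | u , uv , detours = detour⇒∈MEGSet G uv detours connected

mainTheorem11 : (n : ℕ) → 2 ≤ n → (G : Graph n) → WellPartitionedChordal G →
    (k : ℕ) → (K : Subset n) → (∀ x → (x ∈ K ⇔ IsCutVertex G x)) → ∣ K ∣ ≡ k →
    MegEquals G (n ∸ k)
mainTheorem11 n 2≤n G (_ , WP) _ K K⇔cut refl =
  (∁ K , ⊇nonCut⇒MEGSet G (connected WP) cut? (∁ K) (λ _ → nonCut∈∁K) , ∣∁p∣≡n∸∣p∣ K) ,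
  λ M meg → subst (_≤ ∣ M ∣) (∣∁p∣≡n∸∣p∣ K)
              (p⊆q⇒∣p∣≤∣q∣ λ x∈∁K → nonCut∈MEGSet WP 2≤n (∁K⇒nonCut x∈∁K) M meg)
  where
  cut? : Decidable (IsCutVertex G)
  cut? x = Dec.map (K⇔cut x) (x ∈? K)
  nonCut∈∁K : ∀ {x} → ¬ IsCutVertex G x → x ∈ ∁ K
  nonCut∈∁K {x} ¬cut = x∉p⇒x∈∁p (¬cut ∘ Equivalence.to (K⇔cut x))
  ∁K⇒nonCut : ∀ {x} → x ∈ ∁ K → ¬ IsCutVertex G x
  ∁K⇒nonCut {x} x∈∁K = x∈∁p⇒x∉p x∈∁K ∘ Equivalence.from (K⇔cut x)
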